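{- Let $G$ be a simple connected graph with $p \geq 2$ vertices and diameter $d$. Let $L_0$ be any nonempty set of vertices of $G$ (the vertex set of an induced subgraph of $G$), and let $k = \max\{d(u,v) : u,v \in L_0\}$, where $d$ denotes the distance in $G$. Define $L_1 = N(L_0)\setminus L_0$ and recursively $L_{i+1} = N(L_i)\setminus (L_0\cup \cdots \cup L_i)$, where $N(S)$ is the set of vertices adjacent to some vertex of $S$; let $h$ be the largest index with $L_h \neq \emptyset$. Let $\delta = 0$ if $|L_0|\geq 2$ and $\delta = 1$ if $|L_0| = 1$. Then $$\mathrm{rn}(G) \geq (p-1)(d-k+1)+\delta-2\sum_{i=0}^{h}|L_i|\, i.$$
   Context: A radio labeling of a connected graph $G$ is a map $\varphi: V(G)\to\{0,1,2,\dots\}$ such that $d(u,v)+|\varphi(u)-\varphi(v)| \geq \mathrm{diam}(G)+1$ for every pair of distinct vertices $u,v$, where $d(u,v)$ is the graph distance and $\mathrm{diam}(G)$ the diameter. The span of $\varphi$ is $\max\{|\varphi(u)-\varphi(v)| : u,v\in V(G)\}$, and the radio number $\mathrm{rn}(G)$ is the minimum span over all radio labelings of $G$. Note that $L_i$ is exactly the set of vertices at distance $i$ from $L_0$. -}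

module Defs where

open import Data.Bool using (Bool; true; false; _∧_; _∨_; not; if_then_else_)
open import Data.Nat using (ℕ; zero; suc; _+_; _*_; _≤_; _⊔_; ∣_-_∣)
open import Data.Fin using (Fin)
open import Data.List using (List; []; _∷_; map; foldr; concatMap; allFin; upTo)
open import Data.Nat.ListAction using (sum)
open import Data.Bool.ListAction using (any)
open import Data.Product using (Σ; _×_; _,_)
open import Relation.Binary.PropositionalEquality using (_≡_; _≢_)

record SimpleGraph (p : ℕ) : Set where
  field
    adj   : Fin p → Fin p → Bool
    sym   : ∀ u v → adj u v ≡ adj v u
    irrfl : ∀ v → adj v v ≡ false
open SimpleGraph public

data Walk {p : ℕ} (G : SimpleGraph p) : Fin p → Fin p → ℕ → Set where
  here : ∀ {v} → Walk G v v 0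
  step : ∀ {u w v n} → adj G u w ≡ true → Walk G w v n → Walk G u v (suc n)

-- dist is the graph distance of G: d(u,v) is the minimum length of a u–v walk
-- (in particular every pair is joined by a walk, i.e. G is connected).
IsDistance : ∀ {p} → SimpleGraph p → (Fin p → Fin p → ℕ) → Set
IsDistance G dist =
  (∀ u v → Walk G u v (dist u v)) × (∀ u v n → Walk G u v n → dist u v ≤ n)

VSet : ℕ → Set
VSet p = Fin p → Bool

maxList : List ℕ → ℕ
maxList = foldr _⊔_ 0

pairs : ∀ {p} → (Fin p → Fin p → ℕ) → List ℕ
pairs {p} f = concatMap (λ u → map (λ v → f u v) (allFin p)) (allFin p)

diameter : ∀ {p} → (Fin p → Fin p → ℕ) → ℕ
diameter dist = maxList (pairs dist)

diamIn : ∀ {p} → (Fin p → Fin p → ℕ) → VSet p → ℕ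
diamIn dist S = maxList (pairs (λ u v → if S u ∧ S v then dist u v else 0))

card : ∀ {p} → VSet p → ℕ
card {p} S = sum (map (λ v → if S v then 1 else 0) (allFin p))

nbhd : ∀ {p} → SimpleGraph p → VSet p → VSet p
nbhd {p} G S v = any (λ u → S u ∧ adj G u v) (allFin p)

mutual
  layer : ∀ {p} → SimpleGraph p → VSet p → ℕ → VSet p
  layer G L0 zero = L0
  layer G L0 (suc i) v = nbhd G (layer G L0 i) v ∧ not (upto G L0 i v)

  upto : ∀ {p} → SimpleGraph p → VSet p → ℕ → VSet p
  upto G L0 zero = L0
  upto G L0 (suc i) v = upto G L0 i v ∨ layer G L0 (suc i) v

Nonempty : ∀ {p} → VSet p → Set
Nonempty S = Σ _ λ v → S v ≡ true

IsEmpty : ∀ {p} → VSet p → Set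
IsEmpty S = ∀ v → S v ≡ false

IsRadioLabeling : ∀ {p} → (Fin p → Fin p → ℕ) → (Fin p → ℕ) → Set
IsRadioLabeling dist φ =
  ∀ u v → u ≢ v → suc (diameter dist) ≤ dist u v + ∣ φ u - φ v ∣

span : ∀ {p} → (Fin p → ℕ) → ℕ
span φ = maxList (pairs (λ u v → ∣ φ u - φ v ∣))

deltaOf : ℕ → ℕ
deltaOf 1 = 1
deltaOf _ = 0

layerSum : ∀ {p} → SimpleGraph p → VSet p → ℕ → ℕ
layerSum G L0 h = sum (map (λ i → card (layer G L0 i) * i) (upTo (suc h)))

module Submission where

-- Order the vertices x₀, …, x_{p−1} by label. For consecutive vertices the radio condition gives
-- φ(x_{i+1}) − φ(x_i) ≥ diam + 1 − d(x_i, x_{i+1}), and d(x, y) ≤ ℓ(x) + k + ℓ(y), where ℓ(v) is the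
-- index of the layer of v: walk from x down to L₀, across L₀, and back up to y. Summing the p − 1
-- gaps counts every vertex twice except the two ends, so
--   span φ ≥ (p − 1)(diam − k + 1) − 2 Σ_v ℓ(v) + ℓ(x₀) + ℓ(x_{p−1}),  with Σ_v ℓ(v) = Σ_i |L_i| i.
-- If |L₀| = 1 the two (distinct) ends cannot both lie in L₀, so ℓ(x₀) + ℓ(x_{p−1}) ≥ 1 = δ.

open import Defs renaming (sym to adj-sym)
open import Data.Fin using (Fin)

module _ where
  open import Data.Bool using (Bool; true; false; _∧_; _∨_; not; if_then_else_)
  open import Data.Bool.Properties using (∧-conicalˡ; ∧-conicalʳ; ∨-identityʳ; T-≡)
  open import Data.Bool.ListAction using (any)
  open import Data.Nat
  open import Data.Nat.Properties
  open import Data.Nat.Tactic.RingSolver using (solve-∀)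
  open import Data.Nat.ListAction using (sum)
  open import Data.Nat.ListAction.Properties using (sum-↭)
  open import Data.List using (List; []; _∷_; map; allFin; upTo; length)
  open import Data.List.Properties using (map-cong; length-tabulate)
  open import Data.List.Membership.Propositional using (_∈_; lose)
  open import Data.List.Membership.Propositional.Properties using (∈-allFin; ∈-upTo⁺; ∈-map⁺; ∈-concatMap⁺)
  open import Data.List.Relation.Unary.Any using (here; there; satisfied)
  open import Data.List.Relation.Unary.Any.Properties using (any⁺; any⁻)
  open import Data.List.Relation.Unary.All using (_∷_) renaming (lookup to All-lookup)
  open import Data.List.Relation.Unary.AllPairs using (_∷_)
  open import Data.List.Relation.Unary.Linked as Linked using (Linked; _∷_)
  open import Data.List.Relation.Unary.Linked.Properties using (AllPairs⇒Linked)
  open import Data.List.Relation.Unary.Unique.Propositional using (Unique)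
  open import Data.List.Relation.Unary.Unique.Propositional.Properties using (allFin⁺)
  open import Data.List.Relation.Binary.Permutation.Propositional using (_↭_; ↭⇒↭ₛ; ↭-sym)
  open import Data.List.Relation.Binary.Permutation.Propositional.Properties using (↭-length; map⁺)
  import Data.List.Relation.Binary.Permutation.Setoid.Properties as SetoidPerm
  import Data.List.Sort as Sort
  open import Data.Product using (∃-syntax; _×_; _,_; proj₁; proj₂)
  open import Data.Sum using (_⊎_; inj₁; inj₂)
  open import Data.Empty using (⊥-elim)
  open import Function using (_on_)
  open import Function.Bundles using (Equivalence)
  import Relation.Binary.Construct.On as On
  open import Relation.Binary.PropositionalEquality
  open import Relation.Nullary using (contradiction)

  private
    variable
      A B : Set

  indicator : Bool → ℕ
  indicator b = if b then 1 else 0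

  ∨-true⁻ : ∀ a {b} → a ∨ b ≡ true → a ≡ true ⊎ b ≡ true
  ∨-true⁻ true _ = inj₁ refl
  ∨-true⁻ false b = inj₂ b

  ∨-∧-not : ∀ a {b} → b ≡ true → a ∨ (b ∧ not a) ≡ true
  ∨-∧-not true _ = refl
  ∨-∧-not false refl = refl

  ∈⇒≤maxList : ∀ {x xs} → x ∈ xs → x ≤ maxList xs
  ∈⇒≤maxList {xs = y ∷ ys} (here refl) = m≤m⊔n y (maxList ys)
  ∈⇒≤maxList {xs = y ∷ ys} (there x∈ys) = ≤-trans (∈⇒≤maxList x∈ys) (m≤n⊔m y (maxList ys))

  ≤maxList-pairs : ∀ {p} (f : Fin p → Fin p → ℕ) u v → f u v ≤ maxList (pairs f)
  ≤maxList-pairs {p} f u v =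
    ∈⇒≤maxList (∈-concatMap⁺ (λ u → map (f u) (allFin p)) (lose (∈-allFin u) (∈-map⁺ (f u) (∈-allFin v))))

  ≤+span : ∀ {p} (φ : Fin p → ℕ) u v → φ u ≤ φ v + span φ
  ≤+span φ u v = ≤-trans (m≤n+m∸n (φ u) (φ v))
    (+-monoʳ-≤ (φ v) (≤-trans (m∸n≤∣m-n∣ (φ u) (φ v)) (≤maxList-pairs (λ u v → ∣ φ u - φ v ∣) u v)))

  ∈⇒≤sum-map : ∀ (f : A → ℕ) {x xs} → x ∈ xs → f x ≤ sum (map f xs)
  ∈⇒≤sum-map f {xs = y ∷ ys} (here refl) = m≤m+n (f y) _
  ∈⇒≤sum-map f {xs = y ∷ ys} (there x∈ys) = ≤-trans (∈⇒≤sum-map f x∈ys) (m≤n+m _ (f y))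

  ∈-distinct⇒+≤sum-map : ∀ (f : A → ℕ) {x y xs} → x ∈ xs → y ∈ xs → x ≢ y →
                         f x + f y ≤ sum (map f xs)
  ∈-distinct⇒+≤sum-map f (here refl) (here refl) x≢y = ⊥-elim (x≢y refl)
  ∈-distinct⇒+≤sum-map f (here refl) (there y∈zs) _ = +-monoʳ-≤ _ (∈⇒≤sum-map f y∈zs)
  ∈-distinct⇒+≤sum-map f {x} {y} (there x∈zs) (here refl) _ =
    ≤-trans (≤-reflexive (+-comm (f x) (f y))) (+-monoʳ-≤ (f y) (∈⇒≤sum-map f x∈zs))
  ∈-distinct⇒+≤sum-map f {xs = z ∷ _} (there x∈zs) (there y∈zs) x≢y =
    ≤-trans (∈-distinct⇒+≤sum-map f x∈zs y∈zs x≢y) (m≤n+m _ (f z))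

  sum-map-+ : ∀ (f g : A → ℕ) xs → sum (map (λ x → f x + g x) xs) ≡ sum (map f xs) + sum (map g xs)
  sum-map-+ f g [] = refl
  sum-map-+ f g (x ∷ xs) =
    trans (cong (f x + g x +_) (sum-map-+ f g xs)) (interchange (f x) (g x) _ _)
    where
    interchange : ∀ a b c d → a + b + (c + d) ≡ a + c + (b + d)
    interchange = solve-∀

  sum-map-*ʳ : ∀ (f : A → ℕ) c xs → sum (map f xs) * c ≡ sum (map (λ x → f x * c) xs)
  sum-map-*ʳ f c [] = refl
  sum-map-*ʳ f c (x ∷ xs) = trans (*-distribʳ-+ c (f x) _) (cong (f x * c +_) (sum-map-*ʳ f c xs))

  sum-map-zero : ∀ (xs : List A) → sum (map (λ _ → 0) xs) ≡ 0
  sum-map-zero [] = refl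
  sum-map-zero (_ ∷ xs) = sum-map-zero xs

  sum-map-swap : ∀ (g : A → B → ℕ) xs ys →
                 sum (map (λ x → sum (map (g x) ys)) xs) ≡ sum (map (λ y → sum (map (λ x → g x y) xs)) ys)
  sum-map-swap g [] ys = sym (sum-map-zero ys)
  sum-map-swap g (x ∷ xs) ys =
    trans (cong (sum (map (g x) ys) +_) (sum-map-swap g xs ys))
          (sym (sum-map-+ (g x) (λ y → sum (map (λ x → g x y) xs)) ys))

  length≡p : ∀ {p} {xs : List (Fin p)} → xs ↭ allFin p → length xs ≡ p
  length≡p {p} perm = trans (↭-length perm) (length-tabulate (λ i → i))

  last⁺ : A → List A → A
  last⁺ x [] = x
  last⁺ _ (y ∷ ys) = last⁺ y ys

  last⁺-∈ : ∀ (x : A) xs → last⁺ x xs ∈ x ∷ xs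
  last⁺-∈ x [] = here refl
  last⁺-∈ _ (y ∷ ys) = there (last⁺-∈ y ys)

  module _ (φ w : A → ℕ) (a b : ℕ) where

    telescope : ∀ x xs → Linked (λ u v → a + φ u ≤ w u + b + w v + φ v) (x ∷ xs) →
                length xs * a + w x + w (last⁺ x xs) + φ x
                  ≤ φ (last⁺ x xs) + 2 * sum (map w (x ∷ xs)) + length xs * b
    telescope x [] _ = ≤-reflexive (shuffle (w x) (φ x))
      where
      shuffle : ∀ wx φx → 0 + wx + wx + φx ≡ φx + 2 * (wx + 0) + 0
      shuffle = solve-∀
    telescope x (y ∷ ys) (gap ∷ rest) = +-cancelʳ-≤ (w y + φ y) _ _ (begin
        suc n * a + w x + w l + φ x + (w y + φ y)         ≡⟨ split (n * a) a (w x) (w y) (w l) (φ x) (φ y) ⟩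
        n * a + w y + w l + φ y + (a + φ x) + w x         ≤⟨ +-monoˡ-≤ (w x) (+-mono-≤ (telescope y ys rest) gap) ⟩
        φ l + 2 * S + n * b + (w x + b + w y + φ y) + w x ≡⟨ merge (φ l) S (n * b) b (w x) (w y) (φ y) ⟩
        φ l + 2 * (w x + S) + suc n * b + (w y + φ y)     ∎)
      where
      open ≤-Reasoning
      n S : ℕ
      n = length ys
      S = sum (map w (y ∷ ys))
      l : A
      l = last⁺ y ys
      split : ∀ na a wx wy wl φx φy → a + na + wx + wl + φx + (wy + φy) ≡ na + wy + wl + φy + (a + φx) + wx
      split = solve-∀
      merge : ∀ φl S nb b wx wy φy → φl + 2 * S + nb + (wx + b + wy + φy) + wx ≡ φl + 2 * (wx + S) + (b + nb) + (wy + φy)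
      merge = solve-∀

  module _ {p} {G : SimpleGraph p} where

    walk-snoc : ∀ {u v w n} → Walk G u v n → adj G v w ≡ true → Walk G u w (suc n)
    walk-snoc here vw = step vw here
    walk-snoc (step uw walk) vw = step uw (walk-snoc walk vw)

    walk-reverse : ∀ {u v n} → Walk G u v n → Walk G v u n
    walk-reverse here = here
    walk-reverse (step {u} {w} uw walk) = walk-snoc (walk-reverse walk) (trans (adj-sym G w u) uw)

    walk-++ : ∀ {u v w m n} → Walk G u v m → Walk G v w n → Walk G u w (m + n)
    walk-++ here walk = walk
    walk-++ (step uw walk₁) walk₂ = step uw (walk-++ walk₁ walk₂)

  module _ {p} (G : SimpleGraph p) where

    nbhd⁺ : ∀ {S : VSet p} {u v} → S u ≡ true → adj G u v ≡ true → nbhd G S v ≡ true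
    nbhd⁺ {u = u} Su uv =
      Equivalence.to T-≡ (any⁺ _ (lose (∈-allFin u) (Equivalence.from T-≡ (cong₂ _∧_ Su uv))))

    nbhd⁻ : ∀ {S : VSet p} {v} → nbhd G S v ≡ true → ∃[ u ] S u ≡ true × adj G u v ≡ true
    nbhd⁻ {S} {v} N with satisfied (any⁻ _ (allFin p) (Equivalence.from T-≡ N))
    ... | u , Su∧uv = u , ∧-conicalˡ _ _ Su∧uv≡true , ∧-conicalʳ _ _ Su∧uv≡true
      where
      Su∧uv≡true : S u ∧ adj G u v ≡ true
      Su∧uv≡true = Equivalence.to T-≡ Su∧uv

  module Layering {p} (G : SimpleGraph p) (L0 : VSet p) where

    upto-suc : ∀ i {v} → upto G L0 i v ≡ true → upto G L0 (suc i) v ≡ true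
    upto-suc i {v} U = cong (_∨ layer G L0 (suc i) v) U

    upto-mono : ∀ {i j v} → i ≤ j → upto G L0 i v ≡ true → upto G L0 j v ≡ true
    upto-mono {i} {v = v} i≤j = go (≤⇒≤′ i≤j)
      where
      go : ∀ {j} → i ≤′ j → upto G L0 i v ≡ true → upto G L0 j v ≡ true
      go ≤′-refl U = U
      go (≤′-step {j} i≤′j) U = upto-suc j (go i≤′j U)

    upto⇒layer : ∀ i {v} → upto G L0 i v ≡ true → ∃[ j ] j ≤ i × layer G L0 j v ≡ true
    upto⇒layer zero U = 0 , z≤n , U
    upto⇒layer (suc i) {v} U with ∨-true⁻ (upto G L0 i v) U
    ... | inj₁ Ui = let j , j≤i , Lj = upto⇒layer i Ui in j , m≤n⇒m≤1+n j≤i , Lj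
    ... | inj₂ Lv = suc i , ≤-refl , Lv

    -- Definitionally upto (suc j) = upto j ∨ (N (layer j) ∧ not (upto j)), also for j = 0.
    nbhd⇒upto-suc : ∀ j {v} → nbhd G (layer G L0 j) v ≡ true → upto G L0 (suc j) v ≡ true
    nbhd⇒upto-suc j {v} = ∨-∧-not (upto G L0 j v)

    upto-adj : ∀ n {u v} → upto G L0 n u ≡ true → adj G u v ≡ true → upto G L0 (suc n) v ≡ true
    upto-adj n U uv with upto⇒layer n U
    ... | j , j≤n , Lj = upto-mono (s≤s j≤n) (nbhd⇒upto-suc j (nbhd⁺ G Lj uv))

    walk⇒upto : ∀ {u v n} → Walk G u v n → L0 v ≡ true → upto G L0 n u ≡ true
    walk⇒upto here L0v = L0v
    walk⇒upto {u} {n = suc n} (step {w = w} uw walk) L0v =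
      upto-adj n (walk⇒upto walk L0v) (trans (adj-sym G w u) uw)

    layer⇒walk : ∀ i {v} → layer G L0 i v ≡ true → ∃[ a ] L0 a ≡ true × Walk G v a i
    layer⇒walk zero {v} L0v = v , L0v , here
    layer⇒walk (suc i) {v} Lv with nbhd⁻ G (∧-conicalˡ _ _ Lv)
    ... | w , Lw , wv with layer⇒walk i Lw
    ... | a , L0a , walk = a , L0a , step (trans (adj-sym G v w) wv) walk

    module _ (h : ℕ) (empty-beyond-h : ∀ i → h < i → IsEmpty (layer G L0 i)) where

      upto-stable : ∀ m {v} → upto G L0 (m + h) v ≡ true → upto G L0 h v ≡ true
      upto-stable zero U = U
      upto-stable (suc m) {v} U = upto-stable m (begin
        upto G L0 (m + h) v                              ≡⟨ ∨-identityʳ _ ⟨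
        upto G L0 (m + h) v ∨ false                      ≡⟨ cong (upto G L0 (m + h) v ∨_) L≡false ⟨
        upto G L0 (m + h) v ∨ layer G L0 (suc m + h) v   ≡⟨ U ⟩
        true                                             ∎)
        where
        open ≡-Reasoning
        L≡false : layer G L0 (suc m + h) v ≡ false
        L≡false = empty-beyond-h (suc m + h) (s≤s (m≤n+m h m)) v

      walk⇒layer≤h : ∀ {u a n} → Walk G u a n → L0 a ≡ true → ∃[ j ] j ≤ h × layer G L0 j u ≡ true
      walk⇒layer≤h {n = n} walk L0a =
        upto⇒layer h (upto-stable (n ∸ h) (upto-mono n≤[n∸h]+h (walk⇒upto walk L0a)))
        where
        n≤[n∸h]+h : n ≤ (n ∸ h) + h
        n≤[n∸h]+h = ≤-trans (m≤n+m∸n n h) (≤-reflexive (+-comm h (n ∸ h)))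

    -- As the layers are disjoint this is the index of the layer containing v; the sum form makes
    -- Σ_v depth h v = layerSum h a mere exchange of summations, and only j ≤ depth h v for v ∈ L_j
    -- is ever needed about it.
    depth : ℕ → Fin p → ℕ
    depth h v = sum (map (λ i → indicator (layer G L0 i v) * i) (upTo (suc h)))

    layer⇒≤depth : ∀ {h j v} → j ≤ h → layer G L0 j v ≡ true → j ≤ depth h v
    layer⇒≤depth {h} {j} {v} j≤h Lj =
      subst (_≤ depth h v) (trans (cong (λ b → indicator b * j) Lj) (*-identityˡ j))
        (∈⇒≤sum-map (λ i → indicator (layer G L0 i v) * i) (∈-upTo⁺ (s≤s j≤h)))

    layerSum≡sum-depth : ∀ h → layerSum G L0 h ≡ sum (map (depth h) (allFin p))
    layerSum≡sum-depth h = begin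
      sum (map (λ i → card (layer G L0 i) * i) I)                            ≡⟨ cong sum (map-cong per-layer I) ⟩
      sum (map (λ i → sum (map (λ v → indicator (layer G L0 i v) * i) V)) I) ≡⟨ sum-map-swap _ I V ⟩
      sum (map (depth h) V)                                                  ∎
      where
      open ≡-Reasoning
      I : List ℕ
      I = upTo (suc h)
      V : List (Fin p)
      V = allFin p
      per-layer : ∀ i → card (layer G L0 i) * i ≡ sum (map (λ v → indicator (layer G L0 i v) * i) V)
      per-layer i = sum-map-*ʳ (λ v → indicator (layer G L0 i v)) i V

  module RadioBound {p} (G : SimpleGraph p) (dist : Fin p → Fin p → ℕ) (isDist : IsDistance G dist)
                    (L0 : VSet p) (L0-nonempty : Nonempty L0) (h : ℕ)
                    (empty-beyond-h : ∀ i → h < i → IsEmpty (layer G L0 i))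
                    (φ : Fin p → ℕ) (radio : IsRadioLabeling dist φ) where

    open Layering G L0 using (layer⇒walk; walk⇒layer≤h; layer⇒≤depth; layerSum≡sum-depth)

    D k δ : ℕ
    D = diameter dist
    k = diamIn dist L0
    δ = deltaOf (card L0)

    depth : Fin p → ℕ
    depth = Layering.depth G L0 h

    layer-of : ∀ v → ∃[ j ] j ≤ h × layer G L0 j v ≡ true
    layer-of v = walk⇒layer≤h h empty-beyond-h (proj₁ isDist v (proj₁ L0-nonempty)) (proj₂ L0-nonempty)

    dist≤k : ∀ {a b} → L0 a ≡ true → L0 b ≡ true → dist a b ≤ k
    dist≤k {a} {b} L0a L0b = subst (_≤ k) (cong₂ (λ s t → if s ∧ t then dist a b else 0) L0a L0b)
      (≤maxList-pairs (λ u v → if L0 u ∧ L0 v then dist u v else 0) a b)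

    dist≤depth+k+depth : ∀ x y → dist x y ≤ depth x + k + depth y
    dist≤depth+k+depth x y with layer-of x | layer-of y
    ... | i , i≤h , Lx | j , j≤h , Ly with layer⇒walk i Lx | layer⇒walk j Ly
    ... | a , L0a , x→a | b , L0b , y→b = begin
      dist x y                ≤⟨ proj₂ isDist x y _ (walk-++ x→a (walk-++ (proj₁ isDist a b) (walk-reverse y→b))) ⟩
      i + (dist a b + j)      ≤⟨ +-mono-≤ (layer⇒≤depth i≤h Lx) (+-mono-≤ (dist≤k L0a L0b) (layer⇒≤depth j≤h Ly)) ⟩
      depth x + (k + depth y) ≡⟨ +-assoc (depth x) k (depth y) ⟨
      depth x + k + depth y   ∎
      where open ≤-Reasoning

    radio-gap : ∀ {x y} → x ≢ y → φ x ≤ φ y → suc D + φ x ≤ depth x + k + depth y + φ y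
    radio-gap {x} {y} x≢y φx≤φy = begin
      suc D + φ x                    ≤⟨ +-monoˡ-≤ (φ x) (radio x y x≢y) ⟩
      dist x y + ∣ φ x - φ y ∣ + φ x ≡⟨ cong (λ t → dist x y + t + φ x) (m≤n⇒∣m-n∣≡n∸m φx≤φy) ⟩
      dist x y + (φ y ∸ φ x) + φ x   ≡⟨ +-assoc (dist x y) _ (φ x) ⟩
      dist x y + (φ y ∸ φ x + φ x)   ≡⟨ cong (dist x y +_) (m∸n+n≡m φx≤φy) ⟩
      dist x y + φ y                 ≤⟨ +-monoˡ-≤ (φ y) (dist≤depth+k+depth x y) ⟩
      depth x + k + depth y + φ y    ∎
      where open ≤-Reasoning

    depth≡0⇒L0 : ∀ {v} → depth v ≡ 0 → L0 v ≡ true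
    depth≡0⇒L0 {v} depth≡0 with layer-of v
    ... | j , j≤h , Lj = subst (λ i → layer G L0 i v ≡ true) j≡0 Lj
      where
      j≡0 : j ≡ 0
      j≡0 = n≤0⇒n≡0 (subst (j ≤_) depth≡0 (layer⇒≤depth j≤h Lj))

    L0-distinct⇒2≤card : ∀ {x y} → x ≢ y → L0 x ≡ true → L0 y ≡ true → 2 ≤ card L0
    L0-distinct⇒2≤card x≢y L0x L0y =
      subst (_≤ card L0) (cong₂ (λ s t → indicator s + indicator t) L0x L0y)
        (∈-distinct⇒+≤sum-map (λ v → indicator (L0 v)) (∈-allFin _) (∈-allFin _) x≢y)

    δ≤depth+depth : ∀ {x y} → x ≢ y → δ ≤ depth x + depth y
    δ≤depth+depth {x} {y} x≢y with card L0 in |L0| | depth x in dx | depth y in dy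
    ... | 0           | _     | _     = z≤n
    ... | suc (suc _) | _     | _     = z≤n
    ... | 1           | suc _ | _     = s≤s z≤n
    ... | 1           | zero  | suc _ = s≤s z≤n
    ... | 1           | zero  | zero  =
      ⊥-elim (1+n≰n (subst (2 ≤_) |L0| (L0-distinct⇒2≤card x≢y (depth≡0⇒L0 dx) (depth≡0⇒L0 dy))))

    chain-bound : ∀ x xs → Linked (_≤_ on φ) (x ∷ xs) → Unique (x ∷ xs) → x ≢ last⁺ x xs →
                  length xs * suc D + δ ≤ span φ + (2 * sum (map depth (x ∷ xs)) + length xs * k)
    chain-bound x xs sorted distinct x≢l = +-cancelʳ-≤ (φ x) _ _ (begin
      n * suc D + δ + φ x                   ≤⟨ +-monoˡ-≤ (φ x) (+-monoʳ-≤ (n * suc D) (δ≤depth+depth x≢l)) ⟩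
      n * suc D + (depth x + depth l) + φ x ≡⟨ cong (_+ φ x) (+-assoc (n * suc D) (depth x) (depth l)) ⟨
      n * suc D + depth x + depth l + φ x   ≤⟨ telescope φ depth (suc D) k x xs gaps ⟩
      φ l + 2 * S + n * k                   ≤⟨ +-monoˡ-≤ (n * k) (+-monoˡ-≤ (2 * S) (≤+span φ l x)) ⟩
      φ x + span φ + 2 * S + n * k          ≡⟨ reorder (φ x) (span φ) (2 * S) (n * k) ⟩
      span φ + (2 * S + n * k) + φ x        ∎)
      where
      open ≤-Reasoning
      n S : ℕ
      n = length xs
      S = sum (map depth (x ∷ xs))
      l : Fin p
      l = last⁺ x xs
      gaps : Linked (λ u v → suc D + φ u ≤ depth u + k + depth v + φ v) (x ∷ xs)
      gaps = Linked.zipWith (λ (φu≤φv , u≢v) → radio-gap u≢v φu≤φv) (sorted , AllPairs⇒Linked distinct)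
      reorder : ∀ a b c d → a + b + c + d ≡ b + (c + d) + a
      reorder = solve-∀

    ordering-bound : ∀ xs → xs ↭ allFin p → Linked (_≤_ on φ) xs → Unique xs → 2 ≤ p →
                     (p ∸ 1) * suc D + δ ≤ span φ + (2 * layerSum G L0 h + (p ∸ 1) * k)
    ordering-bound [] perm _ _ 2≤p = contradiction (subst (2 ≤_) (sym (length≡p perm)) 2≤p) λ ()
    ordering-bound (_ ∷ []) perm _ _ 2≤p = contradiction (subst (2 ≤_) (sym (length≡p perm)) 2≤p) 1+n≰n
    ordering-bound (x ∷ xs@(y ∷ ys)) perm sorted distinct@(x≢xs ∷ _) _ =
      subst₂ (λ n S → n * suc D + δ ≤ span φ + (2 * S + n * k)) n≡p∸1 S≡layerSum
        (chain-bound x xs sorted distinct (All-lookup x≢xs (last⁺-∈ y ys)))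
      where
      n≡p∸1 : length xs ≡ p ∸ 1
      n≡p∸1 = cong (_∸ 1) (length≡p perm)
      S≡layerSum : sum (map depth (x ∷ xs)) ≡ layerSum G L0 h
      S≡layerSum = trans (sum-↭ (map⁺ depth perm)) (sym (layerSum≡sum-depth h))

    radio-bound : 2 ≤ p → (p ∸ 1) * suc D + δ ≤ span φ + (2 * layerSum G L0 h + (p ∸ 1) * k)
    radio-bound = ordering-bound (sort (allFin p)) (sort-↭ (allFin p)) (sort-↗ (allFin p))
      (SetoidPerm.Unique-resp-↭ (setoid (Fin p)) (↭⇒↭ₛ (↭-sym (sort-↭ (allFin p)))) (allFin⁺ p))
      where open Sort (On.decTotalOrder ≤-decTotalOrder φ)

open import Data.Nat using (ℕ; _<_; _≤_; _∸_)
open import Data.Integer using (ℤ; +_; -_; _+_; _-_; _*_; +≤+)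
open import Data.Integer using () renaming (_≤_ to _≤ℤ_)
import Data.Nat as ℕ
open import Data.Integer.Properties using (+-monoˡ-≤; pos-+; pos-*)
open import Data.Integer.Tactic.RingSolver using (solve-∀)
open import Relation.Binary.PropositionalEquality using (_≡_; trans; cong; cong₂; subst₂)

ℕ-bound⇒ℤ-bound : ∀ n D k δ S s → n ℕ.* ℕ.suc D ℕ.+ δ ≤ s ℕ.+ (2 ℕ.* S ℕ.+ n ℕ.* k) →
                  + n * (+ D - + k + + 1) + + δ - + 2 * + S ≤ℤ + s
ℕ-bound⇒ℤ-bound n D k δ S s bound =
  subst₂ _≤ℤ_ (rearrange (+ n) (+ D) (+ k) (+ δ) (+ S)) (cancel (+ s) Y)
    (+-monoˡ-≤ (- Y) (subst₂ _≤ℤ_ lhs rhs (+≤+ bound)))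
  where
  Y : ℤ
  Y = + 2 * + S + + n * + k
  lhs : + (n ℕ.* ℕ.suc D ℕ.+ δ) ≡ + n * (+ 1 + + D) + + δ
  lhs = trans (pos-+ (n ℕ.* ℕ.suc D) δ) (cong (_+ + δ) (pos-* n (ℕ.suc D)))
  rhs : + (s ℕ.+ (2 ℕ.* S ℕ.+ n ℕ.* k)) ≡ + s + Y
  rhs = trans (pos-+ s _) (cong (_+_ (+ s)) (trans (pos-+ (2 ℕ.* S) _) (cong₂ _+_ (pos-* 2 S) (pos-* n k))))
  rearrange : ∀ n D k δ S → n * (+ 1 + D) + δ - (+ 2 * S + n * k) ≡ n * (D - k + + 1) + δ - + 2 * S
  rearrange = solve-∀
  cancel : ∀ s y → s + y - y ≡ s
  cancel = solve-∀

theorem1 : (p : ℕ) → 2 ≤ p → (G : SimpleGraph p) → (dist : Fin p → Fin p → ℕ) → IsDistance G dist → (L0 : VSet p) → Nonempty L0 → (h : ℕ) → Nonempty (layer G L0 h) → (∀ i → h < i → IsEmpty (layer G L0 i)) → (φ : Fin p → ℕ) → IsRadioLabeling dist φ → ((+ (p ∸ 1)) * ((+ diameter dist) - (+ diamIn dist L0) + + 1) + + deltaOf (card L0) - + 2 * + layerSum G L0 h) ≤ℤ + span φ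
theorem1 p 2≤p G dist isDist L0 L0-nonempty h _ empty-beyond-h φ radio =
  ℕ-bound⇒ℤ-bound (p ∸ 1) (diameter dist) (diamIn dist L0) (deltaOf (card L0)) (layerSum G L0 h) (span φ)
    (RadioBound.radio-bound G dist isDist L0 L0-nonempty h empty-beyond-h φ radio 2≤p)
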